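{- Let $0<\alpha<1$ be fixed and let $\mathbb{G}(m,m,1/2)$ be the random bipartite graph on $M_1\cup M_2$ with $|M_1|=|M_2|=m$. Then there is a function $g(m)=o(m)$ such that, with probability tending to $1$ as $m\to\infty$, for every $A\subseteq M_1$ and $B\subseteq M_2$ with $|A|=|B|=\alpha m$ there exists a matching between $A$ and $B$ (in $\mathbb{G}(m,m,1/2)$) of size at least $\alpha m - g(m)$.
   Context: $\mathbb{G}(m,m,1/2)$ is the random bipartite graph with vertex classes $M_1,M_2$ of size $m$ in which each of the $m^2$ possible edges between $M_1$ and $M_2$ is present independently with probability $1/2$. Rounding of $\alpha m$ to an integer is ignored. -}

module Defs where

open import Data.Nat using (ℕ; zero; suc; _∸_) renaming (_≤_ to _≤ℕ_; _+_ to _+ℕ_; _*_ to _*ℕ_)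
open import Data.Integer using (+_)
open import Data.Rational using (ℚ; _/_; _+_; _-_; _*_; _≤_; _<_; ∣_∣)
open import Data.Bool using (Bool; true)
open import Data.Fin using (Fin)
open import Data.Fin.Subset using (Subset; _∈_) renaming (∣_∣ to card)
open import Data.Vec using (Vec; lookup)
open import Data.List using (List; length)
open import Data.List.Relation.Unary.All using (All)
open import Data.List.Relation.Unary.Unique.Propositional using (Unique)
open import Data.Product using (Σ; ∃; _×_)
open import Function.Definitions using (Injective)
open import Relation.Binary.PropositionalEquality using (_≡_)

-- Real numbers (Bishop): regular Cauchy sequences of rationals,
--   |x_i - x_j| ≤ 1/(i+1) + 1/(j+1).

ℕ→ℚ : ℕ → ℚ
ℕ→ℚ n = (+ n) / 1

record ℝ : Set where
  field
    seq : ℕ → ℚ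
    reg : ∀ i j → ∣ seq i - seq j ∣ ≤ ((+ 1) / suc i) + ((+ 1) / suc j)
open ℝ public

_≤ℚℝ_ : ℚ → ℝ → Set
q ≤ℚℝ x = ∀ n → q ≤ seq x n + ((+ 2) / suc n)

_<ℝℚ_ : ℝ → ℚ → Set
x <ℝℚ q = ∃ λ n → seq x n + ((+ 2) / suc n) < q

_<ℚℝ_ : ℚ → ℝ → Set
q <ℚℝ x = ∃ λ n → q + ((+ 2) / suc n) < seq x n

_≤ℚ_·ℝ_ : ℚ → ℕ → ℝ → Set
q ≤ℚ m ·ℝ x = ∀ n → q ≤ (ℕ→ℚ m * seq x n) + (ℕ→ℚ m * ((+ 2) / suc n))

_·ℝ_<ℚ_ : ℕ → ℝ → ℚ → Set
m ·ℝ x <ℚ q = ∃ λ n → (ℕ→ℚ m * seq x n) + (ℕ→ℚ m * ((+ 2) / suc n)) < q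

IsRounding : ℝ → ℕ → ℕ → Set
IsRounding α m k = (ℕ→ℚ k ≤ℚ m ·ℝ α) × (m ·ℝ α <ℚ ℕ→ℚ (suc k))

-- Bipartite graphs between M₁ = Fin m and M₂ = Fin m, given by the
-- m×m adjacency table; the 2^(m*m) such tables are equally likely in
-- 𝔾(m,m,1/2).

BipGraph : ℕ → Set
BipGraph m = Vec (Vec Bool m) m

Edge : ∀ {m} → BipGraph m → Fin m → Fin m → Set
Edge G i j = lookup (lookup G i) j ≡ true

record Matching {m} (G : BipGraph m) (A B : Subset m) (s : ℕ) : Set where
  field
    left  : Fin s → Fin m
    right : Fin s → Fin m
    left-inj  : Injective _≡_ _≡_ left
    right-inj : Injective _≡_ _≡_ right
    left∈A    : ∀ e → left e ∈ A
    right∈B   : ∀ e → right e ∈ B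
    isEdge    : ∀ e → Edge G (left e) (right e)

Good : ℝ → (ℕ → ℕ) → (m : ℕ) → BipGraph m → Set
Good α g m G =
  ∀ k → IsRounding α m k →
  (A B : Subset m) → card A ≡ k → card B ≡ k →
  Σ ℕ λ s → (k ∸ g m ≤ℕ s) × Matching G A B s

LittleO : (ℕ → ℕ) → Set
LittleO g = ∀ d → ∃ λ N → ∀ m → N ≤ℕ m → suc d *ℕ g m ≤ℕ m

-- Probability (under 𝔾(m,m,1/2)) of the event P is at least 1 - 1/(d+1):
-- there is a duplicate-free list of graphs, all in the event, whose size
-- L satisfies  (d+1)·(2^(m·m) - L) ≤ 2^(m·m).
ProbAtLeast : (m : ℕ) → (BipGraph m → Set) → ℕ → Set
ProbAtLeast m P d = Σ (List (BipGraph m)) λ S →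
  Unique S × All P S × (suc d *ℕ (Data.Nat._^_ 2 (m *ℕ m) ∸ length S) ≤ℕ Data.Nat._^_ 2 (m *ℕ m))

-- If every pair of t-sets X ⊆ M₁, Y ⊆ M₂ spans an edge, the greedy algorithm matches two
-- k-sets A, B until fewer than t vertices remain on each side, giving a matching of size
-- at least k − t; this holds for every k. A fixed pair X, Y spans no
-- edge in exactly a 2^(−|X||Y|) fraction of the 2^(m²) graphs, and there are at most 4^m
-- pairs, so with t = ⌈√(3m)⌉ = o(m) the graphs violating the hypothesis form a fraction
-- at most 4^m · 2^(−3m) = 2^(−m).
module Submission where

open import Defs
open import Data.Nat using (ℕ; _≤_)
open import Data.Rational using (0ℚ; 1ℚ)
open import Data.Product using (Σ; ∃; _×_)

open import Data.Bool using (Bool; true; false; if_then_else_)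
import Data.Bool as Bool
open import Data.Empty using (⊥-elim)
open import Data.Fin using (Fin; zero; suc)
open import Data.Fin.Properties using (any?)
open import Data.Fin.Subset using (Subset; inside; outside; ⁅_⁆; _─_; _-_; ∣_∣)
  renaming (_∈_ to _∈ₛ_; _∉_ to _∉ₛ_)
open import Data.Fin.Subset.Properties using (p─⊥≡p; p─q⊆p; x∉⁅y⁆⇒x≢y)
  renaming (_∈?_ to _∈ₛ?_)
open import Data.List using (List; []; _∷_; map; length; _++_; cartesianProductWith; cartesianProduct; filter; concatMap)
open import Data.List.Properties using (length-map; length-++; length-filter; filter-notAll)
open import Data.List.Membership.Propositional using (_∈_; lose)
open import Data.List.Membership.Propositional.Properties
  using (∈-cartesianProductWith⁺; ∈-cartesianProduct⁺; ∈-filter⁺; ∈-filter⁻; ∈-++⁺ˡ; ∈-++⁺ʳ; ∈-concatMap⁺)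
import Data.List.Membership.DecPropositional as DecMembership
open import Data.List.Relation.Binary.Subset.Propositional using (_⊆_)
import Data.List.Relation.Unary.Any as Any
open import Data.List.Relation.Unary.Any using (here; there)
open import Data.List.Relation.Unary.All using (All; []; _∷_)
import Data.List.Relation.Unary.All as All
open import Data.List.Relation.Unary.AllPairs using ([]; _∷_)
open import Data.List.Relation.Unary.Unique.Propositional using (Unique)
import Data.List.Relation.Unary.Unique.Propositional.Properties as Unique
open import Data.Nat using (zero; suc; _+_; _*_; _∸_; _^_; z≤n; s≤s; s≤s⁻¹; _≤?_; NonZero)
open import Data.Nat.Properties
open import Algebra.Properties.CommutativeSemigroup *-commutativeSemigroup using (interchange)
open import Data.Product using (_,_; proj₂; uncurry)
open import Data.Vec using (Vec; []; _∷_; lookup; here; there)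
import Data.Vec.Functional as Vector
open import Data.Vec.Properties using (∷-injective; lookup⇒[]=; ≡-dec)
open import Function using (_∘_)
open import Function.Definitions using (Injective)
open import Relation.Binary.Definitions using (DecidableEquality)
open import Relation.Binary.PropositionalEquality
open import Relation.Nullary using (¬_; yes; no; ¬?)
open import Relation.Nullary.Decidable using (_×-dec_)
open import Relation.Unary using (Decidable)

length-cartesianProductWith : ∀ {A B C : Set} (f : A → B → C) xs ys →
  length (cartesianProductWith f xs ys) ≡ length xs * length ys
length-cartesianProductWith f [] ys = refl
length-cartesianProductWith f (x ∷ xs) ys =
  trans (length-++ (map (f x) ys))
        (cong₂ _+_ (length-map (f x) ys) (length-cartesianProductWith f xs ys))

length-concatMap-≤ : ∀ {A B : Set} (f : A → List B) {c D : ℕ} (xs : List A) →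
  All (λ x → length (f x) * c ≤ D) xs → length (concatMap f xs) * c ≤ length xs * D
length-concatMap-≤ f [] [] = z≤n
length-concatMap-≤ f {c} {D} (x ∷ xs) (fx≤D ∷ rest≤) = begin
  length (f x ++ concatMap f xs) * c                   ≡⟨ cong (_* c) (length-++ (f x)) ⟩
  (length (f x) + length (concatMap f xs)) * c         ≡⟨ *-distribʳ-+ c (length (f x)) _ ⟩
  length (f x) * c + length (concatMap f xs) * c       ≤⟨ +-mono-≤ fx≤D (length-concatMap-≤ f xs rest≤) ⟩
  D + length xs * D                                    ∎
  where open ≤-Reasoning

module _ {A : Set} (_≟_ : DecidableEquality A) where

  Unique-⊆⇒length-≤ : ∀ {xs ys : List A} → Unique xs → xs ⊆ ys → length xs ≤ length ys
  Unique-⊆⇒length-≤ {[]} _ _ = z≤n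
  Unique-⊆⇒length-≤ {x ∷ xs} {ys} (x∉xs ∷ unique) x∷xs⊆ys =
    ≤-trans (s≤s (Unique-⊆⇒length-≤ unique xs⊆ys-x)) (filter-notAll (¬? ∘ (_≟ x)) ys x∈ys)
    where
    xs⊆ys-x : xs ⊆ filter (¬? ∘ (_≟ x)) ys
    xs⊆ys-x z∈xs = ∈-filter⁺ (¬? ∘ (_≟ x)) (x∷xs⊆ys (there z∈xs)) (All.lookup x∉xs z∈xs ∘ sym)
    x∈ys : Any.Any (λ y → ¬ ¬ y ≡ x) ys
    x∈ys = Any.map (λ x≡y y≢x → y≢x (sym x≡y)) (x∷xs⊆ys (here refl))

choices : ∀ {A : Set} {n} → (Fin n → List A) → List (Vec A n)
choices {n = zero}  _ = [] ∷ []
choices {n = suc n} L = cartesianProductWith _∷_ (L zero) (choices (L ∘ suc))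

length-choices-const : ∀ {A : Set} (xs : List A) n → length (choices {n = n} (λ _ → xs)) ≡ length xs ^ n
length-choices-const xs zero = refl
length-choices-const xs (suc n) =
  trans (length-cartesianProductWith _∷_ xs _) (cong (length xs *_) (length-choices-const xs n))

length-choices-weighted : ∀ {A : Set} (f : Bool → List A) {c D : ℕ} →
  length (f true) * c ≡ D → length (f false) ≡ D →
  ∀ {n} (X : Subset n) → length (choices (f ∘ lookup X)) * c ^ ∣ X ∣ ≡ D ^ n
length-choices-weighted f ht hf [] = refl
length-choices-weighted f {c} {D} ht hf {suc n} (true ∷ X) = begin
  length (cartesianProductWith _∷_ (f true) rest) * (c * c ^ ∣ X ∣) ≡⟨ cong (_* _) (length-cartesianProductWith _∷_ (f true) rest) ⟩
  length (f true) * length rest * (c * c ^ ∣ X ∣)                  ≡⟨ interchange (length (f true)) _ c _ ⟩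
  length (f true) * c * (length rest * c ^ ∣ X ∣)                  ≡⟨ cong₂ _*_ ht (length-choices-weighted f ht hf X) ⟩
  D * D ^ n                                                        ∎
  where open ≡-Reasoning
        rest = choices (f ∘ lookup X)
length-choices-weighted f {c} {D} ht hf {suc n} (false ∷ X) = begin
  length (cartesianProductWith _∷_ (f false) rest) * c ^ ∣ X ∣ ≡⟨ cong (_* _) (length-cartesianProductWith _∷_ (f false) rest) ⟩
  length (f false) * length rest * c ^ ∣ X ∣                  ≡⟨ *-assoc (length (f false)) _ _ ⟩
  length (f false) * (length rest * c ^ ∣ X ∣)                ≡⟨ cong₂ _*_ hf (length-choices-weighted f ht hf X) ⟩
  D * D ^ n                                                   ∎
  where open ≡-Reasoning
        rest = choices (f ∘ lookup X)

∈-choices⁺ : ∀ {A : Set} {n} {L : Fin n → List A} (v : Vec A n) → (∀ i → lookup v i ∈ L i) → v ∈ choices L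
∈-choices⁺ [] _ = here refl
∈-choices⁺ (a ∷ v) v∈L = ∈-cartesianProductWith⁺ _∷_ (v∈L zero) (∈-choices⁺ v (v∈L ∘ suc))

Unique-choices : ∀ {A : Set} {n} {L : Fin n → List A} → (∀ i → Unique (L i)) → Unique (choices L)
Unique-choices {n = zero}  _ = [] ∷ []
Unique-choices {n = suc n} unique =
  Unique.cartesianProductWith⁺ _∷_ ∷-injective (unique zero) (Unique-choices (unique ∘ suc))

bools : List Bool
bools = true ∷ false ∷ []

∈-bools : ∀ b → b ∈ bools
∈-bools true  = here refl
∈-bools false = there (here refl)

Unique-bools : Unique bools
Unique-bools = ((λ ()) ∷ []) ∷ [] ∷ []

rows : ∀ m → List (Vec Bool m)
rows m = choices (λ _ → bools)

graphs : ∀ m → List (BipGraph m)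
graphs m = choices (λ _ → rows m)

rowsAvoiding : ∀ {m} → Subset m → List (Vec Bool m)
rowsAvoiding Y = choices (λ j → if lookup Y j then false ∷ [] else bools)

graphsAvoiding : ∀ {m} → Subset m → Subset m → List (BipGraph m)
graphsAvoiding {m} X Y = choices (λ i → if lookup X i then rowsAvoiding Y else rows m)

length-rows : ∀ m → length (rows m) ≡ 2 ^ m
length-rows = length-choices-const bools

length-graphs : ∀ m → length (graphs m) ≡ 2 ^ (m * m)
length-graphs m = begin
  length (graphs m) ≡⟨ length-choices-const (rows m) m ⟩
  length (rows m) ^ m ≡⟨ cong (_^ m) (length-rows m) ⟩
  (2 ^ m) ^ m ≡⟨ ^-*-assoc 2 m m ⟩
  2 ^ (m * m) ∎
  where open ≡-Reasoning

length-rowsAvoiding : ∀ {m} (Y : Subset m) → length (rowsAvoiding Y) * 2 ^ ∣ Y ∣ ≡ 2 ^ m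
length-rowsAvoiding = length-choices-weighted (λ b → if b then false ∷ [] else bools) refl refl

length-graphsAvoiding : ∀ {m} (X Y : Subset m) → length (graphsAvoiding X Y) * 2 ^ (∣ Y ∣ * ∣ X ∣) ≡ 2 ^ (m * m)
length-graphsAvoiding {m} X Y = begin
  length (graphsAvoiding X Y) * 2 ^ (∣ Y ∣ * ∣ X ∣)   ≡⟨ cong (length (graphsAvoiding X Y) *_) (^-*-assoc 2 ∣ Y ∣ ∣ X ∣) ⟨
  length (graphsAvoiding X Y) * (2 ^ ∣ Y ∣) ^ ∣ X ∣   ≡⟨ length-choices-weighted (λ b → if b then rowsAvoiding Y else rows m)
                                                            (length-rowsAvoiding Y) (length-rows m) X ⟩
  (2 ^ m) ^ m                                       ≡⟨ ^-*-assoc 2 m m ⟩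
  2 ^ (m * m)                                       ∎
  where open ≡-Reasoning

∈-rows : ∀ {m} (r : Vec Bool m) → r ∈ rows m
∈-rows r = ∈-choices⁺ r (∈-bools ∘ lookup r)

∈-graphs : ∀ {m} (G : BipGraph m) → G ∈ graphs m
∈-graphs G = ∈-choices⁺ G (∈-rows ∘ lookup G)

Unique-graphs : ∀ m → Unique (graphs m)
Unique-graphs m = Unique-choices (λ _ → Unique-choices (λ _ → Unique-bools))

∈-rowsAvoiding : ∀ {m} (Y : Subset m) (r : Vec Bool m) →
  (∀ j → j ∈ₛ Y → lookup r j ≢ true) → r ∈ rowsAvoiding Y
∈-rowsAvoiding Y r avoids = ∈-choices⁺ r entry
  where
  entry : ∀ j → lookup r j ∈ (if lookup Y j then false ∷ [] else bools)
  entry j with lookup Y j in j∈Y | lookup r j in rⱼ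
  ... | false | b     = ∈-bools b
  ... | true  | false = here refl
  ... | true  | true  = ⊥-elim (avoids j (lookup⇒[]= j Y j∈Y) rⱼ)

∈-graphsAvoiding : ∀ {m} (X Y : Subset m) (G : BipGraph m) →
  (∀ i j → i ∈ₛ X → j ∈ₛ Y → ¬ Edge G i j) → G ∈ graphsAvoiding X Y
∈-graphsAvoiding X Y G avoids = ∈-choices⁺ G row
  where
  row : ∀ i → lookup G i ∈ (if lookup X i then rowsAvoiding Y else rows _)
  row i with lookup X i in i∈X
  ... | true  = ∈-rowsAvoiding Y (lookup G i) (λ j → avoids i j (lookup⇒[]= i X i∈X))
  ... | false = ∈-rows (lookup G i)

x∈p─q⇒x∉q : ∀ {n} (p q : Subset n) {x} → x ∈ₛ p ─ q → x ∉ₛ q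
x∈p─q⇒x∉q (_ ∷ p) (outside ∷ q) here ()
x∈p─q⇒x∉q (_ ∷ p) (_ ∷ q) (there x∈p─q) (there x∈q) = x∈p─q⇒x∉q p q x∈p─q x∈q

x∈p-y⇒x≢y : ∀ {n} {p : Subset n} {x y} → x ∈ₛ p - y → x ≢ y
x∈p-y⇒x≢y {p = p} {y = y} = x∉⁅y⁆⇒x≢y ∘ x∈p─q⇒x∉q p ⁅ y ⁆

∣p∣≤1+∣p-x∣ : ∀ {n} (p : Subset n) x → ∣ p ∣ ≤ suc ∣ p - x ∣
∣p∣≤1+∣p-x∣ (outside ∷ p) zero    = m≤n⇒m≤1+n (≤-reflexive (cong ∣_∣ (sym (p─⊥≡p p))))
∣p∣≤1+∣p-x∣ (inside  ∷ p) zero    = s≤s (≤-reflexive (cong ∣_∣ (sym (p─⊥≡p p))))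
∣p∣≤1+∣p-x∣ (outside ∷ p) (suc x) = ∣p∣≤1+∣p-x∣ p x
∣p∣≤1+∣p-x∣ (inside  ∷ p) (suc x) = s≤s (∣p∣≤1+∣p-x∣ p x)

injective-∷ : ∀ {A : Set} {n} {x : A} {f : Fin n → A} →
  Injective _≡_ _≡_ f → (∀ k → f k ≢ x) → Injective _≡_ _≡_ (x Vector.∷ f)
injective-∷ inj fresh {zero}  {zero}  _  = refl
injective-∷ inj fresh {zero}  {suc l} eq = ⊥-elim (fresh l (sym eq))
injective-∷ inj fresh {suc k} {zero}  eq = ⊥-elim (fresh k eq)
injective-∷ inj fresh {suc k} {suc l} eq = cong suc (inj eq)

JoinsLargeSets : ∀ {m} → BipGraph m → ℕ → Set
JoinsLargeSets {m} G t = ∀ (X Y : Subset m) → t ≤ ∣ X ∣ → t ≤ ∣ Y ∣ →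
  ∃ λ i → ∃ λ j → i ∈ₛ X × j ∈ₛ Y × Edge G i j

module _ {m} (G : BipGraph m) where
  open Matching

  emptyMatching : ∀ A B → Matching G A B 0
  emptyMatching A B = record
    { left = λ () ; right = λ () ; left-inj = λ { {()} } ; right-inj = λ { {()} }
    ; left∈A = λ () ; right∈B = λ () ; isEdge = λ () }

  extendMatching : ∀ {A B s i j} → i ∈ₛ A → j ∈ₛ B → Edge G i j →
    Matching G (A - i) (B - j) s → Matching G A B (suc s)
  extendMatching {A} {B} {i = i} {j} i∈A j∈B edge M = record
    { left      = i Vector.∷ left M
    ; right     = j Vector.∷ right M
    ; left-inj  = injective-∷ (left-inj M) (x∈p-y⇒x≢y ∘ left∈A M)
    ; right-inj = injective-∷ (right-inj M) (x∈p-y⇒x≢y ∘ right∈B M)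
    ; left∈A    = λ { zero → i∈A ; (suc k) → p─q⊆p A ⁅ i ⁆ (left∈A M k) }
    ; right∈B   = λ { zero → j∈B ; (suc k) → p─q⊆p B ⁅ j ⁆ (right∈B M k) }
    ; isEdge    = λ { zero → edge ; (suc k) → isEdge M k } }

  greedyMatching : ∀ {t} → JoinsLargeSets G t → ∀ n (A B : Subset m) → n ≤ ∣ A ∣ → n ≤ ∣ B ∣ →
    Σ ℕ λ s → n ∸ t ≤ s × Matching G A B s
  greedyMatching {t} joins zero A B _ _ = 0 , m∸n≤m 0 t , emptyMatching A B
  greedyMatching {t} joins (suc n) A B n<∣A∣ n<∣B∣ with t ≤? n
  ... | no t≰n = 0 , ≤-reflexive (m≤n⇒m∸n≡0 (≰⇒> t≰n)) , emptyMatching A B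
  ... | yes t≤n =
    let i , j , i∈A , j∈B , edge = joins A B (≤-trans t≤n (<⇒≤ n<∣A∣)) (≤-trans t≤n (<⇒≤ n<∣B∣))
        s , n∸t≤s , M = greedyMatching joins n (A - i) (B - j)
                          (s≤s⁻¹ (≤-trans n<∣A∣ (∣p∣≤1+∣p-x∣ A i)))
                          (s≤s⁻¹ (≤-trans n<∣B∣ (∣p∣≤1+∣p-x∣ B j)))
    in suc s , ≤-trans (≤-reflexive (+-∸-assoc 1 t≤n)) (s≤s n∸t≤s) , extendMatching i∈A j∈B edge M

_≟ᴳ_ : ∀ {m} → DecidableEquality (BipGraph m)
_≟ᴳ_ = ≡-dec (≡-dec Bool._≟_)

module JoinedGraphs (m t : ℕ) where
  open DecMembership (_≟ᴳ_ {m}) using (_∈?_)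

  Large : Subset m × Subset m → Set
  Large (X , Y) = t ≤ ∣ X ∣ × t ≤ ∣ Y ∣

  large? : Decidable Large
  large? (X , Y) = (t ≤? ∣ X ∣) ×-dec (t ≤? ∣ Y ∣)

  largePairs : List (Subset m × Subset m)
  largePairs = filter large? (cartesianProduct (rows m) (rows m))

  -- A graph avoiding several large pairs occurs several times: the length is a union bound.
  unjoined : List (BipGraph m)
  unjoined = concatMap (uncurry graphsAvoiding) largePairs

  notUnjoined? : Decidable (λ G → ¬ G ∈ unjoined)
  notUnjoined? G = ¬? (G ∈? unjoined)

  joined : List (BipGraph m)
  joined = filter notUnjoined? (graphs m)

  joined⇒JoinsLargeSets : ∀ {G} → G ∈ joined → JoinsLargeSets G t
  joined⇒JoinsLargeSets {G} G∈joined X Y t≤∣X∣ t≤∣Y∣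
    with any? (λ i → any? (λ j → (i ∈ₛ? X) ×-dec (j ∈ₛ? Y) ×-dec (lookup (lookup G i) j Bool.≟ true)))
  ... | yes edge  = edge
  ... | no noEdge = ⊥-elim (proj₂ (∈-filter⁻ notUnjoined? {xs = graphs m} G∈joined) G∈unjoined)
    where
    G∈unjoined : G ∈ unjoined
    G∈unjoined = ∈-concatMap⁺ (uncurry graphsAvoiding) (lose
      (∈-filter⁺ large? (∈-cartesianProduct⁺ (∈-rows X) (∈-rows Y)) (t≤∣X∣ , t≤∣Y∣))
      (∈-graphsAvoiding X Y G λ i j i∈X j∈Y e → noEdge (i , j , i∈X , j∈Y , e)))

  graphs⊆joined++unjoined : graphs m ⊆ joined ++ unjoined
  graphs⊆joined++unjoined {G} G∈graphs with G ∈? unjoined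
  ... | yes G∈unjoined = ∈-++⁺ʳ joined G∈unjoined
  ... | no  G∉unjoined = ∈-++⁺ˡ (∈-filter⁺ notUnjoined? G∈graphs G∉unjoined)

  length-largePairs : length largePairs ≤ 2 ^ m * 2 ^ m
  length-largePairs = ≤-trans (length-filter large? (cartesianProduct (rows m) (rows m)))
    (≤-reflexive (trans (length-cartesianProductWith _,_ (rows m) (rows m))
                        (cong₂ _*_ (length-rows m) (length-rows m))))

  length-unjoined : length unjoined * 2 ^ (t * t) ≤ 2 ^ m * 2 ^ m * 2 ^ (m * m)
  length-unjoined = ≤-trans
    (length-concatMap-≤ (uncurry graphsAvoiding) {2 ^ (t * t)} {2 ^ (m * m)} largePairs
      (All.tabulate λ {p} p∈ → avoidingBound p (proj₂ (∈-filter⁻ large? {xs = cartesianProduct (rows m) (rows m)} p∈))))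
    (*-monoˡ-≤ (2 ^ (m * m)) length-largePairs)
    where
    avoidingBound : ∀ p → Large p → length (uncurry graphsAvoiding p) * 2 ^ (t * t) ≤ 2 ^ (m * m)
    avoidingBound (X , Y) (t≤∣X∣ , t≤∣Y∣) =
      ≤-trans (*-monoʳ-≤ (length (graphsAvoiding X Y)) (^-monoʳ-≤ 2 (*-mono-≤ t≤∣Y∣ t≤∣X∣))) (≤-reflexive (length-graphsAvoiding X Y))

  missing≤unjoined : 2 ^ (m * m) ∸ length joined ≤ length unjoined
  missing≤unjoined = m≤n+o⇒m∸n≤o _ (length joined) (begin
    2 ^ (m * m)                       ≡⟨ length-graphs m ⟨
    length (graphs m)                 ≤⟨ Unique-⊆⇒length-≤ _≟ᴳ_
                                           (Unique-graphs m) graphs⊆joined++unjoined ⟩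
    length (joined ++ unjoined)       ≡⟨ length-++ joined ⟩
    length joined + length unjoined   ∎)
    where open ≤-Reasoning

  joined-likely : ∀ d → suc d * (2 ^ m * 2 ^ m) ≤ 2 ^ (t * t) →
    suc d * (2 ^ (m * m) ∸ length joined) ≤ 2 ^ (m * m)
  joined-likely d hyp = *-cancelʳ-≤ (suc d * (2 ^ (m * m) ∸ length joined)) (2 ^ (m * m)) (2 ^ (t * t)) {{m^n≢0 2 (t * t)}} (begin
    suc d * (2 ^ (m * m) ∸ length joined) * 2 ^ (t * t) ≤⟨ *-monoˡ-≤ (2 ^ (t * t)) (*-monoʳ-≤ (suc d) missing≤unjoined) ⟩
    suc d * length unjoined * 2 ^ (t * t)               ≡⟨ *-assoc (suc d) (length unjoined) (2 ^ (t * t)) ⟩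
    suc d * (length unjoined * 2 ^ (t * t))             ≤⟨ *-monoʳ-≤ (suc d) length-unjoined ⟩
    suc d * (2 ^ m * 2 ^ m * 2 ^ (m * m))               ≡⟨ *-assoc (suc d) (2 ^ m * 2 ^ m) (2 ^ (m * m)) ⟨
    suc d * (2 ^ m * 2 ^ m) * 2 ^ (m * m)               ≤⟨ *-monoˡ-≤ (2 ^ (m * m)) hyp ⟩
    2 ^ (t * t) * 2 ^ (m * m)                           ≡⟨ *-comm (2 ^ (t * t)) (2 ^ (m * m)) ⟩
    2 ^ (m * m) * 2 ^ (t * t)                           ∎)
    where open ≤-Reasoning

⌈√_⌉ : ℕ → ℕ
⌈√ zero  ⌉ = zero
⌈√ suc n ⌉ with suc n ≤? ⌈√ n ⌉ * ⌈√ n ⌉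
... | yes _ = ⌈√ n ⌉
... | no  _ = suc ⌈√ n ⌉

n≤⌈√n⌉² : ∀ n → n ≤ ⌈√ n ⌉ * ⌈√ n ⌉
n≤⌈√n⌉² zero = z≤n
n≤⌈√n⌉² (suc n) with suc n ≤? ⌈√ n ⌉ * ⌈√ n ⌉
... | yes 1+n≤r² = 1+n≤r²
... | no  _       = s≤s (≤-trans (n≤⌈√n⌉² n)
                       (≤-trans (*-monoʳ-≤ ⌈√ n ⌉ (n≤1+n ⌈√ n ⌉)) (m≤n+m _ ⌈√ n ⌉)))

[⌈√n⌉∸1]²≤n : ∀ n → (⌈√ n ⌉ ∸ 1) * (⌈√ n ⌉ ∸ 1) ≤ n
[⌈√n⌉∸1]²≤n zero = z≤n
[⌈√n⌉∸1]²≤n (suc n) with suc n ≤? ⌈√ n ⌉ * ⌈√ n ⌉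
... | yes _    = m≤n⇒m≤1+n ([⌈√n⌉∸1]²≤n n)
... | no  r²≤n = <⇒≤ (≰⇒> r²≤n)

*-suc-≤-square : ∀ a u → a + a ≤ u → a * suc u ≤ u * u
*-suc-≤-square a zero    2a≤0 = ≤-trans (≤-trans (≤-reflexive (*-identityʳ a)) (m≤m+n a a)) 2a≤0
*-suc-≤-square a (suc u) 2a≤u = begin
  a * suc (suc u)           ≡⟨ *-suc a (suc u) ⟩
  a + a * suc u             ≤⟨ +-monoˡ-≤ _ (m≤m*n a (suc u)) ⟩
  a * suc u + a * suc u     ≡⟨ *-distribʳ-+ (suc u) a a ⟨
  (a + a) * suc u           ≤⟨ *-monoˡ-≤ (suc u) 2a≤u ⟩
  suc u * suc u             ∎
  where open ≤-Reasoning

littleO-⌈√⌉ : ∀ c .{{_ : NonZero c}} → LittleO (λ m → ⌈√ (c * m) ⌉)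
littleO-⌈√⌉ c d = D * (c * D + c * D) , bound
  where
  D = suc d
  bound : ∀ m → D * (c * D + c * D) ≤ m → D * ⌈√ (c * m) ⌉ ≤ m
  bound m N≤m with (c * D + c * D) ≤? ⌈√ (c * m) ⌉ ∸ 1
  ... | yes 2cD≤u = *-cancelˡ-≤ c (begin
    c * (D * r)         ≤⟨ *-monoʳ-≤ c (*-monoʳ-≤ D r≤1+u) ⟩
    c * (D * suc u)     ≡⟨ *-assoc c D (suc u) ⟨
    c * D * suc u       ≤⟨ *-suc-≤-square (c * D) u 2cD≤u ⟩
    u * u               ≤⟨ [⌈√n⌉∸1]²≤n (c * m) ⟩
    c * m               ∎)
    where
    open ≤-Reasoning
    r = ⌈√ (c * m) ⌉
    u = r ∸ 1
    r≤1+u : r ≤ suc u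
    r≤1+u = m≤n+m∸n r 1
  ... | no u≱2cD = begin
    D * ⌈√ (c * m) ⌉            ≤⟨ *-monoʳ-≤ D (m≤n+m∸n ⌈√ (c * m) ⌉ 1) ⟩
    D * suc (⌈√ (c * m) ⌉ ∸ 1)  ≤⟨ *-monoʳ-≤ D (≰⇒> u≱2cD) ⟩
    D * (c * D + c * D)         ≤⟨ N≤m ⟩
    m                           ∎
    where open ≤-Reasoning

suc-n≤2^n : ∀ n → suc n ≤ 2 ^ n
suc-n≤2^n zero    = s≤s z≤n
suc-n≤2^n (suc n) = ≤-trans (≤-reflexive (+-comm 1 (suc n)))
  (+-mono-≤ (suc-n≤2^n n) (≤-trans (m^n>0 2 n) (m≤m+n (2 ^ n) 0)))

4^m-below-2^⌈√3m⌉² : ∀ d m → d ≤ m → suc d * (2 ^ m * 2 ^ m) ≤ 2 ^ (⌈√ (3 * m) ⌉ * ⌈√ (3 * m) ⌉)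
4^m-below-2^⌈√3m⌉² d m d≤m = begin
  suc d * (2 ^ m * 2 ^ m)   ≤⟨ *-monoˡ-≤ _ (≤-trans (s≤s d≤m) (suc-n≤2^n m)) ⟩
  2 ^ m * (2 ^ m * 2 ^ m)   ≡⟨ 2^3m ⟨
  2 ^ (3 * m)               ≤⟨ ^-monoʳ-≤ 2 (n≤⌈√n⌉² (3 * m)) ⟩
  2 ^ (⌈√ (3 * m) ⌉ * ⌈√ (3 * m) ⌉) ∎
  where
  open ≤-Reasoning
  2^3m : 2 ^ (3 * m) ≡ 2 ^ m * (2 ^ m * 2 ^ m)
  2^3m = begin-equality
    2 ^ (3 * m)         ≡⟨ cong (2 ^_) (*-comm 3 m) ⟩
    2 ^ (m * 3)         ≡⟨ ^-*-assoc 2 m 3 ⟨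
    (2 ^ m) ^ 3         ≡⟨ cong (λ k → 2 ^ m * (2 ^ m * k)) (*-identityʳ (2 ^ m)) ⟩
    2 ^ m * (2 ^ m * 2 ^ m) ∎

lemma3p2 : (α : ℝ) → 0ℚ <ℚℝ α → α <ℝℚ 1ℚ →
    Σ (ℕ → ℕ) λ g → LittleO g ×
      (∀ d → ∃ λ N → ∀ m → N ≤ m → ProbAtLeast m (Good α g m) d)
lemma3p2 α _ _ = t , littleO-⌈√⌉ 3 , λ d → d , λ m d≤m →
  let open JoinedGraphs m (t m) in
  joined ,
  Unique.filter⁺ notUnjoined? (Unique-graphs m) ,
  All.tabulate (λ G∈joined k _ A B ∣A∣≡k ∣B∣≡k →
    greedyMatching _ (joined⇒JoinsLargeSets G∈joined) k A B (≤-reflexive (sym ∣A∣≡k)) (≤-reflexive (sym ∣B∣≡k))) ,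
  joined-likely d (4^m-below-2^⌈√3m⌉² d m d≤m)
  where
  t : ℕ → ℕ
  t m = ⌈√ (3 * m) ⌉
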